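{- Let $q$ be a prime power with $q\equiv 5\pmod 8$ and consider the directed graph $\mathcal{J}_{\mathbb{F}_q}$ defined below. Then every vertex of $\mathcal{J}_{\mathbb{F}_q}$ has either exactly $2$ or exactly $0$ children.
   Context: $\mathbb{F}_q$ is the finite field with $q$ elements. $\phi_q\colon \mathbb{F}_q^\times\to\{\pm1\}$ is the quadratic character: $\phi_q(a)=1$ if $a$ is a square in $\mathbb{F}_q^\times$ and $-1$ otherwise. The directed graph $\mathcal{J}_{\mathbb{F}_q}=(V,E)$ has vertex set $V=\{(a,b)\in(\mathbb{F}_q^\times)^2 : \phi_q(ab)=1,\ a\neq \pm b\}$, and for $(a,b),(c,d)\in V$ there is an edge $(a,b)\to(c,d)$ if and only if $c=\frac{a+b}{2}$ and $d^2=ab$. A vertex $u$ is a child of $v$ if there is an edge $v\to u$, and a parent of $v$ if there is an edge $u\to v$. -}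

module Defs where

open import Level using (0ℓ)
open import Data.Nat using (ℕ; suc; _%_; _≥_)
open import Data.Nat.Primality using (Prime)
open import Data.Fin using (Fin)
open import Data.Product using (Σ; ∃; ∃-syntax; _×_; _,_)
open import Data.Sum using (_⊎_)
open import Relation.Nullary using (¬_; Dec)
open import Relation.Binary.PropositionalEquality using (_≡_; _≢_)
open import Relation.Binary.Definitions using (DecidableEquality)
open import Algebra.Structures using (IsCommutativeRing)
open import Function.Bundles using (_↔_)

IsPrimePower : ℕ → Set
IsPrimePower q = Σ ℕ λ p → Σ ℕ λ k → Prime p × k ≥ 1 × q ≡ p Data.Nat.^ k

record Field : Set₁ where
  infixl 6 _+_
  infixl 7 _*_
  field
    Carrier : Set
    _+_ _*_ : Carrier → Carrier → Carrier
    -_      : Carrier → Carrier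
    0# 1#   : Carrier
    isCommutativeRing : IsCommutativeRing _≡_ _+_ _*_ -_ 0# 1#
    0≢1     : 0# ≢ 1#
    inverse : ∀ x → x ≢ 0# → ∃[ y ] (x * y ≡ 1#)
    _≟_     : DecidableEquality Carrier

record FiniteField (q : ℕ) : Set₁ where
  field
    field′ : Field
  open Field field′ public
  field
    enumeration : Carrier ↔ Fin q

module JGraph {q : ℕ} (F : FiniteField q) where
  open FiniteField F

  2# : Carrier
  2# = 1# + 1#

  -- a is a square in F_q^×  (i.e. φ_q(a) = 1, for a ≠ 0)
  IsSquareUnit : Carrier → Set
  IsSquareUnit a = ∃[ x ] (x ≢ 0# × x * x ≡ a)

  IsVertex : Carrier × Carrier → Set
  IsVertex (a , b) =
    a ≢ 0# × b ≢ 0# × IsSquareUnit (a * b) × a ≢ b × a ≢ - b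

  -- Edge (a,b) → (c,d): c = (a+b)/2 (i.e. 2c = a + b, 2 invertible as q odd)
  -- and d² = ab.
  Edge : Carrier × Carrier → Carrier × Carrier → Set
  Edge (a , b) (c , d) = 2# * c ≡ a + b × d * d ≡ a * b

  IsChild : Carrier × Carrier → Carrier × Carrier → Set
  IsChild v u = IsVertex u × Edge v u

  NoChildren : Carrier × Carrier → Set
  NoChildren v = ∀ u → ¬ IsChild v u

  ExactlyTwoChildren : Carrier × Carrier → Set
  ExactlyTwoChildren v =
    Σ (Carrier × Carrier) λ u₁ → Σ (Carrier × Carrier) λ u₂ →
      u₁ ≢ u₂ × IsChild v u₁ × IsChild v u₂ ×
      (∀ u → IsChild v u → u ≡ u₁ ⊎ u ≡ u₂)

module Submission where

open import Defs
open import Level using (0ℓ)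
open import Data.Bool.Base using (true; false; if_then_else_)
open import Data.Nat.Base as ℕ using (ℕ; zero; suc; _%_)
import Data.Nat.Properties as ℕ
open import Data.Nat.Divisibility using (divides)
open import Data.Nat.DivMod using (m∣n⇒o%n%m≡o%m; [m+kn]%n≡m%n; m*n%n≡0)
open import Data.Nat.Tactic.RingSolver using (solve-∀)
open import Data.Fin.Base as Fin using (Fin; punchIn)
open import Data.Fin.Properties as Fin using (_<?_; <-cmp; <-asym; <-irrefl; ≤∧≢⇒<; punchInᵢ≢i)
open import Data.Fin.Permutation using (permutation)
open import Data.Product using (∃; ∃-syntax; ∄-syntax; _,_; _×_; proj₁; proj₂)
open import Data.Sum using (_⊎_; inj₁; inj₂; [_,_]′; reduce)
open import Function using (_∘_; _↔_; Inverse; _⇔_; mk⇔)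
open import Relation.Nullary using (Dec; yes; no; does; ¬_; contradiction)
open import Relation.Nullary.Decidable using (dec-true; dec-false; does-⇔; map′; _×-dec_; ¬?; decidable-stable)
open import Relation.Unary using (Pred; Decidable)
open import Relation.Binary using (tri<; tri≈; tri>)
open import Relation.Binary.Definitions using (DecidableEquality)
open import Relation.Binary.PropositionalEquality
open import Algebra.Bundles using (CommutativeRing)
import Algebra.Properties.Ring as RingProperties
import Algebra.Solver.Ring.NaturalCoefficients.Default as NaturalSolver
open import Algebra.Properties.CommutativeMonoid.Sum ℕ.+-0-commutativeMonoid
  using (sum; sum-cong-≗; sum-permute; sum-remove; ∑-distrib-+; sum-replicate-zero)

-- Write (a, b) for a vertex with ab = x², x ≠ 0.  An edge (a, b) → (c, d) forces c = (a + b)/2 and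
-- d = ±x, and (c, ±x) then satisfies every vertex condition except possibly that c·(±x) be a square:
-- c = ±d would give c² = ab and 2c = a + b, hence a = b.  So the theorem says that c·x and -c·x are
-- squares together, i.e. that -1 is a square in F.
-- Both needed facts about F come from counting fixed points of involutions modulo 2.  If 2 = 0 then
-- x ↦ x + 1 has none and q is even.  Otherwise negation pairs F^× into classes {x, -x}; inversion on
-- these (q - 1)/2 classes is an involution whose fixed classes are {±1} and the square roots of -1.
-- With no square root of -1 the number of classes is odd, so q ≡ 3 (mod 4), contradicting q ≡ 5 (mod 8).

module _ {q : ℕ} (q%8≡5 : q % 8 ≡ 5) where
  open import Data.Nat.Base using (_+_; _*_)

  q%8≡5⇒q≢m+m : ∀ m → q ≢ m + m
  q%8≡5⇒q≢m+m m refl = 1≢0 (begin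
    1                  ≡⟨ cong (_% 2) q%8≡5 ⟨
    (m + m) % 8 % 2    ≡⟨ m∣n⇒o%n%m≡o%m 2 8 (m + m) (divides 4 refl) ⟩
    (m + m) % 2        ≡⟨ cong (_% 2) (m+m≡m*2 m) ⟩
    (m * 2) % 2        ≡⟨ m*n%n≡0 m 2 ⟩
    0                  ∎)
    where
    open ≡-Reasoning
    m+m≡m*2 : ∀ m → m + m ≡ m * 2
    m+m≡m*2 = solve-∀
    1≢0 : 1 ≢ 0
    1≢0 ()

  q%8≡5⇒q≢3+k*4 : ∀ k → q ≢ 3 + k * 4
  q%8≡5⇒q≢3+k*4 k refl = 1≢3 (begin
    1                      ≡⟨ cong (_% 4) q%8≡5 ⟨
    (3 + k * 4) % 8 % 4    ≡⟨ m∣n⇒o%n%m≡o%m 4 8 (3 + k * 4) (divides 2 refl) ⟩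
    (3 + k * 4) % 4        ≡⟨ [m+kn]%n≡m%n 3 k 4 ⟩
    3                      ∎)
    where
    open ≡-Reasoning
    1≢3 : 1 ≢ 3
    1≢3 ()

module Counting where
  open import Data.Nat.Base using (_+_; _*_)
  open import Data.Nat.Properties using (+-identityʳ; *-identityˡ; *-identityʳ; *-distribˡ-+)

  𝟙 : ∀ {p} {P : Set p} → Dec P → ℕ
  𝟙 P? = if does P? then 1 else 0

  𝟙-yes : ∀ {p} {P : Set p} (P? : Dec P) → P → 𝟙 P? ≡ 1
  𝟙-yes P? p = cong (λ b → if b then 1 else 0) (dec-true P? p)

  𝟙-no : ∀ {p} {P : Set p} (P? : Dec P) → ¬ P → 𝟙 P? ≡ 0
  𝟙-no P? ¬p = cong (λ b → if b then 1 else 0) (dec-false P? ¬p)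

  𝟙-cong : ∀ {p q} {P : Set p} {Q : Set q} → P ⇔ Q → (P? : Dec P) (Q? : Dec Q) → 𝟙 P? ≡ 𝟙 Q?
  𝟙-cong P⇔Q P? Q? = cong (λ b → if b then 1 else 0) (does-⇔ P⇔Q P? Q?)

  𝟙-× : ∀ {p q} {P : Set p} {Q : Set q} (P? : Dec P) (Q? : Dec Q) → 𝟙 P? * 𝟙 Q? ≡ 𝟙 (P? ×-dec Q?)
  𝟙-× P? Q? with does P?
  ... | true  = +-identityʳ (𝟙 Q?)
  ... | false = refl

  𝟙<+𝟙>+𝟙≡ : ∀ {n} (i j : Fin n) → 𝟙 (i <? j) + 𝟙 (j <? i) + 𝟙 (i Fin.≟ j) ≡ 1
  𝟙<+𝟙>+𝟙≡ i j with <-cmp i j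
  ... | tri< i<j _ _ = cong₂ _+_ (cong₂ _+_ (𝟙-yes (i <? j) i<j) (𝟙-no (j <? i) (<-asym i<j)))
                                 (𝟙-no (i Fin.≟ j) (λ { refl → <-irrefl refl i<j }))
  ... | tri≈ _ i≡j _ = cong₂ _+_ (cong₂ _+_ (𝟙-no (i <? j) (<-irrefl i≡j)) (𝟙-no (j <? i) (<-irrefl (sym i≡j))))
                                 (𝟙-yes (i Fin.≟ j) i≡j)
  ... | tri> _ _ j<i = cong₂ _+_ (cong₂ _+_ (𝟙-no (i <? j) (<-asym j<i)) (𝟙-yes (j <? i) j<i))
                                 (𝟙-no (i Fin.≟ j) (λ { refl → <-irrefl refl j<i }))

  sum-1 : ∀ n → sum {n} (λ _ → 1) ≡ n
  sum-1 zero    = refl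
  sum-1 (suc n) = cong suc (sum-1 n)

  sum-𝟙-≡ : ∀ {n} (j : Fin n) → sum (λ i → 𝟙 (i Fin.≟ j)) ≡ 1
  sum-𝟙-≡ {suc n} j = begin
    sum (λ i → 𝟙 (i Fin.≟ j))                             ≡⟨ sum-remove {i = j} (λ i → 𝟙 (i Fin.≟ j)) ⟩
    𝟙 (j Fin.≟ j) + sum (λ i → 𝟙 (punchIn j i Fin.≟ j))  ≡⟨ cong₂ _+_ (𝟙-yes (j Fin.≟ j) refl) (sum-cong-≗ off-diagonal) ⟩
    1 + sum {n} (λ _ → 0)                                 ≡⟨ cong suc (sum-replicate-zero n) ⟩
    1                                                     ∎
    where
    open ≡-Reasoning
    off-diagonal : ∀ i → 𝟙 (punchIn j i Fin.≟ j) ≡ 0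
    off-diagonal i = 𝟙-no (punchIn j i Fin.≟ j) (punchInᵢ≢i j i)

  module Enumerated {A : Set} {n : ℕ} (enumeration : A ↔ Fin n) (_≟_ : DecidableEquality A) where
    open Inverse enumeration public using (to; from)
    open import Algebra.Definitions {A = A} _≡_ using (Involutive)
    open ≡-Reasoning

    to-from : ∀ i → to (from i) ≡ i
    to-from = Inverse.strictlyInverseˡ enumeration

    from-to : ∀ x → from (to x) ≡ x
    from-to = Inverse.strictlyInverseʳ enumeration

    to-injective : ∀ {x y} → to x ≡ to y → x ≡ y
    to-injective {x} {y} tx≡ty = trans (sym (from-to x)) (trans (cong from tx≡ty) (from-to y))

    ∃? : ∀ {p} {P : Pred A p} → Decidable P → Dec (∃ P)
    ∃? {P = P} P? =
      map′ (λ (i , p) → from i , p) (λ (x , p) → to x , subst P (sym (from-to x)) p) (Fin.any? (P? ∘ from))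

    ∑ : (A → ℕ) → ℕ
    ∑ f = sum (f ∘ from)

    ∑-cong : ∀ {f g} → (∀ x → f x ≡ g x) → ∑ f ≡ ∑ g
    ∑-cong f≗g = sum-cong-≗ (f≗g ∘ from)

    ∑-+ : ∀ f g → ∑ (λ x → f x + g x) ≡ ∑ f + ∑ g
    ∑-+ f g = ∑-distrib-+ (f ∘ from) (g ∘ from)

    ∑-0 : ∑ (λ _ → 0) ≡ 0
    ∑-0 = sum-replicate-zero n

    ∑-1 : ∑ (λ _ → 1) ≡ n
    ∑-1 = sum-1 n

    ∑-𝟙-≡ : ∀ a → ∑ (λ x → 𝟙 (x ≟ a)) ≡ 1
    ∑-𝟙-≡ a = trans (sum-cong-≗ (λ i → 𝟙-cong (from≡⇔≡to i) (from i ≟ a) (i Fin.≟ to a))) (sum-𝟙-≡ (to a))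
      where
      from≡⇔≡to : ∀ i → from i ≡ a ⇔ i ≡ to a
      from≡⇔≡to i = mk⇔ (λ { refl → sym (to-from i) }) (λ { refl → from-to a })

    ∑-∘-involution : ∀ τ → Involutive τ → ∀ f → ∑ (f ∘ τ) ≡ ∑ f
    ∑-∘-involution τ τ-involutive f = sym (begin
      sum (f ∘ from)          ≡⟨ sum-permute (f ∘ from) (permutation σ σ σ-involutive σ-involutive) ⟩
      sum (f ∘ from ∘ σ)      ≡⟨ sum-cong-≗ (λ i → cong f (from-to (τ (from i)))) ⟩
      sum (f ∘ τ ∘ from)      ∎)
      where
      σ : Fin n → Fin n
      σ = to ∘ τ ∘ from
      σ-involutive : ∀ i → σ (σ i) ≡ i
      σ-involutive i = begin
        to (τ (from (to (τ (from i)))))  ≡⟨ cong (to ∘ τ) (from-to (τ (from i))) ⟩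
        to (τ (τ (from i)))              ≡⟨ cong to (τ-involutive (from i)) ⟩
        to (from i)                      ≡⟨ to-from i ⟩
        i                                ∎

    before : (A → A) → A → ℕ
    before τ x = 𝟙 (to x <? to (τ x))

    fixed : (A → A) → A → ℕ
    fixed τ x = 𝟙 (τ x ≟ x)

    before+before+fixed : ∀ τ → Involutive τ → ∀ x → before τ x + before τ (τ x) + fixed τ x ≡ 1
    before+before+fixed τ τ-involutive x = begin
      before τ x + before τ (τ x) + fixed τ x                                  ≡⟨ cong₂ (λ s t → before τ x + s + t) after fixed≡ ⟩
      𝟙 (to x <? to (τ x)) + 𝟙 (to (τ x) <? to x) + 𝟙 (to x Fin.≟ to (τ x))  ≡⟨ 𝟙<+𝟙>+𝟙≡ (to x) (to (τ x)) ⟩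
      1                                                                        ∎
      where
      after : before τ (τ x) ≡ 𝟙 (to (τ x) <? to x)
      after = cong (λ y → 𝟙 (to (τ x) <? to y)) (τ-involutive x)
      fixed⇔ : τ x ≡ x ⇔ to x ≡ to (τ x)
      fixed⇔ = mk⇔ (λ τx≡x → cong to (sym τx≡x)) (λ tx≡tτx → sym (to-injective tx≡tτx))
      fixed≡ : fixed τ x ≡ 𝟙 (to x Fin.≟ to (τ x))
      fixed≡ = 𝟙-cong fixed⇔ (τ x ≟ x) (to x Fin.≟ to (τ x))

    ∑-involution : ∀ τ → Involutive τ → ∀ {w} → (∀ x → w (τ x) ≡ w x) →
                   ∑ w ≡ ∑ (λ x → w x * before τ x) + ∑ (λ x → w x * before τ x) + ∑ (λ x → w x * fixed τ x)
    ∑-involution τ τ-involutive {w} w∘τ≗w = begin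
      ∑ w                                            ≡⟨ ∑-cong split ⟩
      ∑ (λ x → lower x + lower (τ x) + onFixed x)    ≡⟨ ∑-+ (λ x → lower x + lower (τ x)) onFixed ⟩
      ∑ (λ x → lower x + lower (τ x)) + ∑ onFixed    ≡⟨ cong (_+ ∑ onFixed) (∑-+ lower (lower ∘ τ)) ⟩
      ∑ lower + ∑ (lower ∘ τ) + ∑ onFixed            ≡⟨ cong (λ s → ∑ lower + s + ∑ onFixed) (∑-∘-involution τ τ-involutive lower) ⟩
      ∑ lower + ∑ lower + ∑ onFixed                  ∎
      where
      lower onFixed : A → ℕ
      lower x = w x * before τ x
      onFixed x = w x * fixed τ x
      split : ∀ x → w x ≡ lower x + lower (τ x) + onFixed x
      split x = begin
        w x                                                     ≡⟨ *-identityʳ (w x) ⟨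
        w x * 1                                                 ≡⟨ cong (w x *_) (before+before+fixed τ τ-involutive x) ⟨
        w x * (before τ x + before τ (τ x) + fixed τ x)         ≡⟨ *-distribˡ-+ (w x) (before τ x + before τ (τ x)) (fixed τ x) ⟩
        w x * (before τ x + before τ (τ x)) + onFixed x         ≡⟨ cong (_+ onFixed x) (*-distribˡ-+ (w x) (before τ x) (before τ (τ x))) ⟩
        lower x + w x * before τ (τ x) + onFixed x              ≡⟨ cong (λ s → lower x + s * before τ (τ x) + onFixed x) (w∘τ≗w x) ⟨
        lower x + lower (τ x) + onFixed x                       ∎

    card-involution : ∀ τ → Involutive τ → n ≡ ∑ (before τ) + ∑ (before τ) + ∑ (fixed τ)
    card-involution τ τ-involutive = begin
      n                                                                             ≡⟨ ∑-1 ⟨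
      ∑ (λ _ → 1)                                                                   ≡⟨ ∑-involution τ τ-involutive (λ _ → refl) ⟩
      ∑ (λ x → 1 * before τ x) + ∑ (λ x → 1 * before τ x) + ∑ (λ x → 1 * fixed τ x) ≡⟨ cong₂ (λ s t → s + s + t) (drop-1* (before τ)) (drop-1* (fixed τ)) ⟩
      ∑ (before τ) + ∑ (before τ) + ∑ (fixed τ)                                     ∎
      where
      drop-1* : ∀ f → ∑ (λ x → 1 * f x) ≡ ∑ f
      drop-1* f = ∑-cong (*-identityˡ ∘ f)

module FieldProperties (F : Field) where
  open Field F

  commutativeRing : CommutativeRing 0ℓ 0ℓ
  commutativeRing = record { isCommutativeRing = isCommutativeRing }

  open CommutativeRing commutativeRing public
    using (+-identityˡ; +-identityʳ; *-identityˡ; zeroʳ; +-comm; +-assoc; *-comm; *-assoc; distribʳ; -‿inverseʳ; ring)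
  open RingProperties ring public
    using (-‿distribˡ-*; -‿distribʳ-*; -‿involutive; -1*x≈-x; +-cancelʳ; +-inverseˡ-unique; +-identityʳ-unique; -0#≈0#; x∙y⁻¹≈ε⇒x≈y)
  open NaturalSolver (CommutativeRing.commutativeSemiring commutativeRing)
  open ≡-Reasoning

  2# : Carrier
  2# = 1# + 1#

  2*x≡x+x : ∀ x → 2# * x ≡ x + x
  2*x≡x+x x = trans (distribʳ x 1# 1#) (cong₂ _+_ (*-identityˡ x) (*-identityˡ x))

  -x*-y≡x*y : ∀ x y → - x * - y ≡ x * y
  -x*-y≡x*y x y = begin
    - x * - y     ≡⟨ -‿distribˡ-* x (- y) ⟨
    - (x * - y)   ≡⟨ cong -_ (-‿distribʳ-* x y) ⟨
    - - (x * y)   ≡⟨ -‿involutive (x * y) ⟩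
    x * y         ∎

  1≢0 : 1# ≢ 0#
  1≢0 1≡0 = 0≢1 (sym 1≡0)

  -x≢0 : ∀ {x} → x ≢ 0# → - x ≢ 0#
  -x≢0 {x} x≢0 -x≡0 = x≢0 (trans (sym (-‿involutive x)) (trans (cong -_ -x≡0) -0#≈0#))

  -- The inverse as a total function; 0# ⁻¹ is the junk value 0#.
  _⁻¹ : Carrier → Carrier
  x ⁻¹ with x ≟ 0#
  ... | yes _   = 0#
  ... | no x≢0 = proj₁ (inverse x x≢0)

  x*x⁻¹≡1 : ∀ {x} → x ≢ 0# → x * x ⁻¹ ≡ 1#
  x*x⁻¹≡1 {x} x≢0 with x ≟ 0#
  ... | yes x≡0 = contradiction x≡0 x≢0
  ... | no x≢0′ = proj₂ (inverse x x≢0′)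

  x⁻¹*[x*y]≡y : ∀ {x} y → x ≢ 0# → x ⁻¹ * (x * y) ≡ y
  x⁻¹*[x*y]≡y {x} y x≢0 = begin
    x ⁻¹ * (x * y)  ≡⟨ *-assoc (x ⁻¹) x y ⟨
    x ⁻¹ * x * y    ≡⟨ cong (_* y) (trans (*-comm (x ⁻¹) x) (x*x⁻¹≡1 x≢0)) ⟩
    1# * y          ≡⟨ *-identityˡ y ⟩
    y               ∎

  x*[x⁻¹*y]≡y : ∀ {x} y → x ≢ 0# → x * (x ⁻¹ * y) ≡ y
  x*[x⁻¹*y]≡y {x} y x≢0 = begin
    x * (x ⁻¹ * y)  ≡⟨ *-assoc x (x ⁻¹) y ⟨
    x * x ⁻¹ * y    ≡⟨ cong (_* y) (x*x⁻¹≡1 x≢0) ⟩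
    1# * y          ≡⟨ *-identityˡ y ⟩
    y               ∎

  *-cancelˡ : ∀ {z} x y → z ≢ 0# → z * x ≡ z * y → x ≡ y
  *-cancelˡ {z} x y z≢0 zx≡zy =
    trans (sym (x⁻¹*[x*y]≡y x z≢0)) (trans (cong (z ⁻¹ *_) zx≡zy) (x⁻¹*[x*y]≡y y z≢0))

  x*y≡0⇒x≡0∨y≡0 : ∀ x y → x * y ≡ 0# → x ≡ 0# ⊎ y ≡ 0#
  x*y≡0⇒x≡0∨y≡0 x y xy≡0 with x ≟ 0#
  ... | yes x≡0 = inj₁ x≡0
  ... | no x≢0  = inj₂ (trans (sym (x⁻¹*[x*y]≡y y x≢0)) (trans (cong (x ⁻¹ *_) xy≡0) (zeroʳ (x ⁻¹))))

  x*y≡1⇒x≢0 : ∀ {x y} → x * y ≡ 1# → x ≢ 0#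
  x*y≡1⇒x≢0 {x} {y} xy≡1 refl = 0≢1 (trans (sym (trans (*-comm 0# y) (zeroʳ y))) xy≡1)

  ⁻¹-unique : ∀ {x y} → x * y ≡ 1# → x ⁻¹ ≡ y
  ⁻¹-unique {x} {y} xy≡1 = *-cancelˡ (x ⁻¹) y x≢0 (trans (x*x⁻¹≡1 x≢0) (sym xy≡1))
    where x≢0 = x*y≡1⇒x≢0 xy≡1

  x⁻¹≢0 : ∀ {x} → x ≢ 0# → x ⁻¹ ≢ 0#
  x⁻¹≢0 {x} x≢0 x⁻¹≡0 = 0≢1 (trans (sym (zeroʳ x)) (trans (cong (x *_) (sym x⁻¹≡0)) (x*x⁻¹≡1 x≢0)))

  infix 4 _≡±_
  _≡±_ : Carrier → Carrier → Set
  x ≡± y = x ≡ y ⊎ x ≡ - y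

  ≡±-sym : ∀ {x y} → x ≡± y → y ≡± x
  ≡±-sym (inj₁ refl)          = inj₁ refl
  ≡±-sym {y = y} (inj₂ refl) = inj₂ (sym (-‿involutive y))

  x*x≡y*y⇒x≡±y : ∀ x y → x * x ≡ y * y → x ≡± y
  x*x≡y*y⇒x≡±y x y xx≡yy with x*y≡0⇒x≡0∨y≡0 (x + - y) (x + y) difference-of-squares
    where
    expand : ∀ x y m → (x + m) * (x + y) ≡ x * x + m * y + x * (y + m)
    expand = solve 3 (λ x y m → (x :+ m) :* (x :+ y) := x :* x :+ m :* y :+ x :* (y :+ m)) refl
    difference-of-squares : (x + - y) * (x + y) ≡ 0#
    difference-of-squares = begin
      (x + - y) * (x + y)                  ≡⟨ expand x y (- y) ⟩
      x * x + - y * y + x * (y + - y)      ≡⟨ cong₂ (λ s t → s + - y * y + x * t) xx≡yy (-‿inverseʳ y) ⟩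
      y * y + - y * y + x * 0#             ≡⟨ cong₂ (λ s t → y * y + s + t) (sym (-‿distribˡ-* y y)) (zeroʳ x) ⟩
      y * y + - (y * y) + 0#               ≡⟨ +-identityʳ _ ⟩
      y * y + - (y * y)                    ≡⟨ -‿inverseʳ (y * y) ⟩
      0#                                   ∎
  ... | inj₁ x-y≡0 = inj₁ (x∙y⁻¹≈ε⇒x≈y x y x-y≡0)
  ... | inj₂ x+y≡0 = inj₂ (+-inverseˡ-unique x y x+y≡0)

  x≡±y⇒x*x≡y*y : ∀ {x y} → x ≡± y → x * x ≡ y * y
  x≡±y⇒x*x≡y*y (inj₁ refl) = refl
  x≡±y⇒x*x≡y*y {y = y} (inj₂ refl) = -x*-y≡x*y y y

  ≡±-≢0 : ∀ {x y} → x ≡± y → y ≢ 0# → x ≢ 0#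
  ≡±-≢0 (inj₁ refl) y≢0 = y≢0
  ≡±-≢0 (inj₂ refl) y≢0 = -x≢0 y≢0

  *-cong-± : ∀ c {x y} → x ≡± y → c * x ≡± c * y
  *-cong-± c (inj₁ refl)         = inj₁ refl
  *-cong-± c {y = y} (inj₂ refl) = inj₂ (sym (-‿distribʳ-* c y))

  ⁻¹-cong-± : ∀ {x y} → x ≢ 0# → y ≡± x ⁻¹ → y ⁻¹ ≡± x
  ⁻¹-cong-± {x} x≢0 (inj₁ refl) = inj₁ (⁻¹-unique (trans (*-comm (x ⁻¹) x) (x*x⁻¹≡1 x≢0)))
  ⁻¹-cong-± {x} x≢0 (inj₂ refl) = inj₂ (⁻¹-unique (trans (-x*-y≡x*y (x ⁻¹) x) (trans (*-comm (x ⁻¹) x) (x*x⁻¹≡1 x≢0))))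

  x≡±x⁻¹⇒x*x≡±1 : ∀ {x} → x ≢ 0# → x ≡± x ⁻¹ → x * x ≡± 1#
  x≡±x⁻¹⇒x*x≡±1 {x} x≢0 (inj₁ x≡x⁻¹) = inj₁ (trans (cong (x *_) x≡x⁻¹) (x*x⁻¹≡1 x≢0))
  x≡±x⁻¹⇒x*x≡±1 {x} x≢0 (inj₂ x≡-x⁻¹) =
    inj₂ (trans (cong (x *_) x≡-x⁻¹) (trans (sym (-‿distribʳ-* x (x ⁻¹))) (cong -_ (x*x⁻¹≡1 x≢0))))

  c+c≡a+b⇒c*c≡a*b⇒a≡c : ∀ {a b c} → c + c ≡ a + b → c * c ≡ a * b → a ≡ c
  c+c≡a+b⇒c*c≡a*b⇒a≡c {a} {b} {c} c+c≡a+b c*c≡a*b =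
    x∙y⁻¹≈ε⇒x≈y a c (reduce (x*y≡0⇒x≡0∨y≡0 (a + - c) (a + - c) square-zero))
    where
    expand : ∀ a b m → (a + m) * (a + m) + a * b ≡ a * (a + b + (m + m)) + m * m
    expand = solve 3 (λ a b m → (a :+ m) :* (a :+ m) :+ a :* b := a :* (a :+ b :+ (m :+ m)) :+ m :* m) refl
    regroup : ∀ c m → c + c + (m + m) ≡ (c + m) + (c + m)
    regroup = solve 2 (λ c m → c :+ c :+ (m :+ m) := (c :+ m) :+ (c :+ m)) refl
    square-zero : (a + - c) * (a + - c) ≡ 0#
    square-zero = +-cancelʳ (a * b) _ _ (begin
      (a + - c) * (a + - c) + a * b        ≡⟨ expand a b (- c) ⟩
      a * (a + b + (- c + - c)) + - c * - c ≡⟨ cong₂ (λ s t → a * (s + (- c + - c)) + t) (sym c+c≡a+b) (-x*-y≡x*y c c) ⟩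
      a * (c + c + (- c + - c)) + c * c    ≡⟨ cong₂ (λ s t → a * s + t) (regroup c (- c)) c*c≡a*b ⟩
      a * ((c + - c) + (c + - c)) + a * b  ≡⟨ cong (λ s → a * (s + s) + a * b) (-‿inverseʳ c) ⟩
      a * (0# + 0#) + a * b                ≡⟨ cong (λ s → s + a * b) (trans (cong (a *_) (+-identityˡ 0#)) (zeroʳ a)) ⟩
      0# + a * b                           ∎)

  c+c≡a+b⇒c*c≡a*b⇒a≡b : ∀ {a b c} → c + c ≡ a + b → c * c ≡ a * b → a ≡ b
  c+c≡a+b⇒c*c≡a*b⇒a≡b {a} {b} c+c≡a+b c*c≡a*b =
    trans (c+c≡a+b⇒c*c≡a*b⇒a≡c c+c≡a+b c*c≡a*b)
          (sym (c+c≡a+b⇒c*c≡a*b⇒a≡c (trans c+c≡a+b (+-comm a b)) (trans c*c≡a*b (*-comm a b))))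

  x≢-x : 2# ≢ 0# → ∀ {x} → x ≢ 0# → x ≢ - x
  x≢-x 2≢0 {x} x≢0 x≡-x with x*y≡0⇒x≡0∨y≡0 2# x (trans (2*x≡x+x x) (trans (cong (x +_) x≡-x) (-‿inverseʳ x)))
  ... | inj₁ 2≡0 = 2≢0 2≡0
  ... | inj₂ x≡0 = x≢0 x≡0

  i*i≡-1⇒[i*y]²≡-y² : ∀ {i} → i * i ≡ - 1# → ∀ y → (i * y) * (i * y) ≡ - (y * y)
  i*i≡-1⇒[i*y]²≡-y² {i} i*i≡-1 y = begin
    (i * y) * (i * y)  ≡⟨ solve 2 (λ i y → (i :* y) :* (i :* y) := (i :* i) :* (y :* y)) refl i y ⟩
    (i * i) * (y * y)  ≡⟨ cong (_* (y * y)) i*i≡-1 ⟩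
    - 1# * (y * y)     ≡⟨ -1*x≈-x (y * y) ⟩
    - (y * y)          ∎

module FiniteFieldProperties {q : ℕ} (F : FiniteField q) where
  open FiniteField F
  open FieldProperties field′
  open Counting
  open Enumerated enumeration _≟_
  open ≡-Reasoning

  2≡0⇒q≡m+m : 2# ≡ 0# → ∃[ m ] q ≡ m ℕ.+ m
  2≡0⇒q≡m+m 2≡0 = ∑ (before succ) , (begin
    q                                                             ≡⟨ card-involution succ succ-involutive ⟩
    ∑ (before succ) ℕ.+ ∑ (before succ) ℕ.+ ∑ (fixed succ)        ≡⟨ cong (∑ (before succ) ℕ.+ ∑ (before succ) ℕ.+_) no-fixed-points ⟩
    ∑ (before succ) ℕ.+ ∑ (before succ) ℕ.+ 0                     ≡⟨ ℕ.+-identityʳ _ ⟩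
    ∑ (before succ) ℕ.+ ∑ (before succ)                           ∎)
    where
    succ : Carrier → Carrier
    succ x = x + 1#
    succ-involutive : ∀ x → succ (succ x) ≡ x
    succ-involutive x = trans (+-assoc x 1# 1#) (trans (cong (x +_) 2≡0) (+-identityʳ x))
    no-fixed-points : ∑ (fixed succ) ≡ 0
    no-fixed-points = trans (∑-cong (λ x → 𝟙-no (succ x ≟ x) (1≢0 ∘ +-identityʳ-unique x 1#))) ∑-0

  module _ (2≢0 : 2# ≢ 0#) where

    Canonical : Pred Carrier 0ℓ
    Canonical x = to x Fin.< to (- x)

    Canonical? : Decidable Canonical
    Canonical? x = to x Fin.<? to (- x)

    ¬Canonical-0 : ¬ Canonical 0#
    ¬Canonical-0 = <-irrefl (cong to (sym -0#≈0#))

    Canonical⇒≢0 : ∀ {x} → Canonical x → x ≢ 0#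
    Canonical⇒≢0 c refl = ¬Canonical-0 c

    Canonical⇒¬Canonical-neg : ∀ {x} → Canonical x → ¬ Canonical (- x)
    Canonical⇒¬Canonical-neg {x} c c′ = <-asym c (subst (λ y → to (- x) Fin.< to y) (-‿involutive x) c′)

    ¬Canonical⇒Canonical-neg : ∀ {x} → x ≢ 0# → ¬ Canonical x → Canonical (- x)
    ¬Canonical⇒Canonical-neg {x} x≢0 ¬c = subst (λ y → to (- x) Fin.< to y) (sym (-‿involutive x))
      (≤∧≢⇒< (ℕ.≮⇒≥ ¬c) (λ to-x≡to-x → x≢-x 2≢0 x≢0 (sym (to-injective to-x≡to-x))))

    canonical : Carrier → Carrier
    canonical y with Canonical? y
    ... | yes _ = y
    ... | no _  = - y

    canonical-± : ∀ y → canonical y ≡± y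
    canonical-± y with Canonical? y
    ... | yes _ = inj₁ refl
    ... | no _  = inj₂ refl

    Canonical-canonical : ∀ {y} → y ≢ 0# → Canonical (canonical y)
    Canonical-canonical {y} y≢0 with Canonical? y
    ... | yes c  = c
    ... | no ¬c = ¬Canonical⇒Canonical-neg y≢0 ¬c

    canonical-unique : ∀ {x y} → Canonical x → y ≡± x → canonical y ≡ x
    canonical-unique {x} c (inj₁ refl) with Canonical? x
    ... | yes _  = refl
    ... | no ¬c = contradiction c ¬c
    canonical-unique {x} c (inj₂ refl) with Canonical? (- x)
    ... | yes c′ = contradiction c′ (Canonical⇒¬Canonical-neg c)
    ... | no _   = -‿involutive x

    -- Inversion on the classes {x, -x}, acting on canonical representatives; the identity elsewhere.
    recip : Carrier → Carrier
    recip x with Canonical? x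
    ... | yes _ = canonical (x ⁻¹)
    ... | no _  = x

    recip-canonical : ∀ {x} → Canonical x → recip x ≡ canonical (x ⁻¹)
    recip-canonical {x} c with Canonical? x
    ... | yes _  = refl
    ... | no ¬c = contradiction c ¬c

    recip-non-canonical : ∀ {x} → ¬ Canonical x → recip x ≡ x
    recip-non-canonical {x} ¬c with Canonical? x
    ... | yes c = contradiction c ¬c
    ... | no _  = refl

    recip≡±⁻¹ : ∀ {x} → Canonical x → recip x ≡± x ⁻¹
    recip≡±⁻¹ {x} c = subst (_≡± x ⁻¹) (sym (recip-canonical c)) (canonical-± (x ⁻¹))

    Canonical-recip : ∀ {x} → Canonical x → Canonical (recip x)
    Canonical-recip c = subst Canonical (sym (recip-canonical c)) (Canonical-canonical (x⁻¹≢0 (Canonical⇒≢0 c)))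

    recip-involutive : ∀ x → recip (recip x) ≡ x
    recip-involutive x = by-cases (Canonical? x)
      where
      by-cases : Dec (Canonical x) → recip (recip x) ≡ x
      by-cases (yes c)  = trans (recip-canonical (Canonical-recip c)) (canonical-unique c (⁻¹-cong-± (Canonical⇒≢0 c) (recip≡±⁻¹ c)))
      by-cases (no ¬c) = trans (cong recip (recip-non-canonical ¬c)) (recip-non-canonical ¬c)

    Canonical-recip⇔ : ∀ x → Canonical (recip x) ⇔ Canonical x
    Canonical-recip⇔ x = by-cases (Canonical? x)
      where
      by-cases : Dec (Canonical x) → Canonical (recip x) ⇔ Canonical x
      by-cases (yes c)  = mk⇔ (λ _ → c) (λ _ → Canonical-recip c)
      by-cases (no ¬c) = mk⇔ (subst Canonical (recip-non-canonical ¬c)) (λ c → contradiction c ¬c)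

    canonical-fixed-point⇔≡canonical-1 : ∄[ i ] i * i ≡ - 1# → ∀ x → (Canonical x × recip x ≡ x) ⇔ x ≡ canonical 1#
    canonical-fixed-point⇔≡canonical-1 no√-1 x = mk⇔ fixed⇒≡canonical-1 ≡canonical-1⇒fixed
      where
      fixed⇒≡canonical-1 : Canonical x × recip x ≡ x → x ≡ canonical 1#
      fixed⇒≡canonical-1 (c , recip-x≡x) with x≡±x⁻¹⇒x*x≡±1 (Canonical⇒≢0 c) (subst (_≡± x ⁻¹) recip-x≡x (recip≡±⁻¹ c))
      ... | inj₁ x*x≡1  = sym (canonical-unique c (≡±-sym (x*x≡y*y⇒x≡±y x 1# (trans x*x≡1 (sym (*-identityˡ 1#))))))
      ... | inj₂ x*x≡-1 = contradiction (x , x*x≡-1) no√-1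
      ≡canonical-1⇒fixed : x ≡ canonical 1# → Canonical x × recip x ≡ x
      ≡canonical-1⇒fixed refl = c , trans (recip-canonical c) (canonical-unique c (inj₁ (⁻¹-unique x*x≡1)))
        where
        c : Canonical x
        c = Canonical-canonical 1≢0
        x*x≡1 : x * x ≡ 1#
        x*x≡1 = trans (x≡±y⇒x*x≡y*y (canonical-± 1#)) (*-identityˡ 1#)

    neg-fixed-point⇔≡0 : ∀ x → - x ≡ x ⇔ x ≡ 0#
    neg-fixed-point⇔≡0 x = mk⇔ -x≡x⇒x≡0 (λ { refl → -0#≈0# })
      where
      -x≡x⇒x≡0 : - x ≡ x → x ≡ 0#
      -x≡x⇒x≡0 -x≡x with x ≟ 0#
      ... | yes x≡0 = x≡0
      ... | no x≢0  = contradiction (sym -x≡x) (x≢-x 2≢0 x≢0)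

    #canonical : ℕ
    #canonical = ∑ (before -_)

    q≡#canonical+#canonical+1 : q ≡ #canonical ℕ.+ #canonical ℕ.+ 1
    q≡#canonical+#canonical+1 = begin
      q                                                   ≡⟨ card-involution -_ -‿involutive ⟩
      #canonical ℕ.+ #canonical ℕ.+ ∑ (fixed -_)          ≡⟨ cong (#canonical ℕ.+ #canonical ℕ.+_) (∑-cong fixed-point-is-0) ⟩
      #canonical ℕ.+ #canonical ℕ.+ ∑ (λ x → 𝟙 (x ≟ 0#))  ≡⟨ cong (#canonical ℕ.+ #canonical ℕ.+_) (∑-𝟙-≡ 0#) ⟩
      #canonical ℕ.+ #canonical ℕ.+ 1                     ∎
      where
      fixed-point-is-0 : ∀ x → fixed -_ x ≡ 𝟙 (x ≟ 0#)
      fixed-point-is-0 x = 𝟙-cong (neg-fixed-point⇔≡0 x) ((- x) ≟ x) (x ≟ 0#)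

    no√-1⇒#canonical≡k+k+1 : ∄[ i ] i * i ≡ - 1# → ∃[ k ] #canonical ≡ k ℕ.+ k ℕ.+ 1
    no√-1⇒#canonical≡k+k+1 no√-1 = k , (begin
      #canonical                                                 ≡⟨ ∑-involution recip recip-involutive before-neg-recip ⟩
      k ℕ.+ k ℕ.+ ∑ (λ x → before -_ x ℕ.* fixed recip x)        ≡⟨ cong (k ℕ.+ k ℕ.+_) (∑-cong fixed-point-is-canonical-1) ⟩
      k ℕ.+ k ℕ.+ ∑ (λ x → 𝟙 (x ≟ canonical 1#))                 ≡⟨ cong (k ℕ.+ k ℕ.+_) (∑-𝟙-≡ (canonical 1#)) ⟩
      k ℕ.+ k ℕ.+ 1                                              ∎)
      where
      k : ℕ
      k = ∑ (λ x → before -_ x ℕ.* before recip x)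
      before-neg-recip : ∀ x → before -_ (recip x) ≡ before -_ x
      before-neg-recip x = 𝟙-cong (Canonical-recip⇔ x) (Canonical? (recip x)) (Canonical? x)
      fixed-point-is-canonical-1 : ∀ x → before -_ x ℕ.* fixed recip x ≡ 𝟙 (x ≟ canonical 1#)
      fixed-point-is-canonical-1 x = trans (𝟙-× (Canonical? x) (recip x ≟ x))
        (𝟙-cong (canonical-fixed-point⇔≡canonical-1 no√-1 x) (Canonical? x ×-dec recip x ≟ x) (x ≟ canonical 1#))

    no√-1⇒q≡3+k*4 : ∄[ i ] i * i ≡ - 1# → ∃[ k ] q ≡ 3 ℕ.+ k ℕ.* 4
    no√-1⇒q≡3+k*4 no√-1 with no√-1⇒#canonical≡k+k+1 no√-1
    ... | k , #canonical≡k+k+1 = k , (begin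
      q                                               ≡⟨ q≡#canonical+#canonical+1 ⟩
      #canonical ℕ.+ #canonical ℕ.+ 1                 ≡⟨ cong (λ s → s ℕ.+ s ℕ.+ 1) #canonical≡k+k+1 ⟩
      (k ℕ.+ k ℕ.+ 1) ℕ.+ (k ℕ.+ k ℕ.+ 1) ℕ.+ 1       ≡⟨ regroup k ⟩
      3 ℕ.+ k ℕ.* 4                                   ∎)
      where
      regroup : ∀ k → (k ℕ.+ k ℕ.+ 1) ℕ.+ (k ℕ.+ k ℕ.+ 1) ℕ.+ 1 ≡ 3 ℕ.+ k ℕ.* 4
      regroup = solve-∀

module Children {q : ℕ} (F : FiniteField q) where
  open FiniteField F
  open FieldProperties field′ hiding (2#)
  open JGraph F
  open Counting.Enumerated enumeration _≟_ using (∃?)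

  IsSquareUnit? : Decidable IsSquareUnit
  IsSquareUnit? z = ∃? (λ y → ¬? (y ≟ 0#) ×-dec ((y * y) ≟ z))

  module _ (2≢0 : 2# ≢ 0#) (√-1 : ∃[ i ] i * i ≡ - 1#) where

    IsSquareUnit-neg : ∀ {z} → IsSquareUnit z → IsSquareUnit (- z)
    IsSquareUnit-neg (y , y≢0 , y*y≡z) =
      i * y , [ i≢0 , y≢0 ]′ ∘ x*y≡0⇒x≡0∨y≡0 i y , trans (i*i≡-1⇒[i*y]²≡-y² i*i≡-1 y) (cong -_ y*y≡z)
      where
      i = proj₁ √-1
      i*i≡-1 = proj₂ √-1
      i≢0 : i ≢ 0#
      i≢0 refl = -x≢0 1≢0 (trans (sym i*i≡-1) (zeroʳ 0#))

    IsSquareUnit-± : ∀ {y z} → y ≡± z → IsSquareUnit y → IsSquareUnit z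
    IsSquareUnit-± (inj₁ refl) sq = sq
    IsSquareUnit-± {z = z} (inj₂ refl) sq = subst IsSquareUnit (-‿involutive z) (IsSquareUnit-neg sq)

    module _ {a b x : Carrier} (x≢0 : x ≢ 0#) (x*x≡a*b : x * x ≡ a * b) (a≢b : a ≢ b) (a≢-b : a ≢ - b) where

      c : Carrier
      c = 2# ⁻¹ * (a + b)

      2*c≡a+b : 2# * c ≡ a + b
      2*c≡a+b = x*[x⁻¹*y]≡y (a + b) 2≢0

      c≢0 : c ≢ 0#
      c≢0 c≡0 = a≢-b (+-inverseˡ-unique a b (trans (sym 2*c≡a+b) (trans (cong (2# *_) c≡0) (zeroʳ 2#))))

      c≢±d : ∀ {d} → d * d ≡ a * b → ¬ (c ≡± d)
      c≢±d d*d≡a*b c≡±d =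
        a≢b (c+c≡a+b⇒c*c≡a*b⇒a≡b (trans (sym (2*x≡x+x c)) 2*c≡a+b) (trans (x≡±y⇒x*x≡y*y c≡±d) d*d≡a*b))

      edge-target : ∀ {c′ d} → Edge (a , b) (c′ , d) → c′ ≡ c × d ≡± x
      edge-target (2*c′≡a+b , d*d≡a*b) =
        *-cancelˡ _ _ 2≢0 (trans 2*c′≡a+b (sym 2*c≡a+b)) , x*x≡y*y⇒x≡±y _ x (trans d*d≡a*b (sym x*x≡a*b))

      child : ∀ {d} → d ≡± x → IsSquareUnit (c * x) → IsChild (a , b) (c , d)
      child d≡±x sq =
        (c≢0 , ≡±-≢0 d≡±x x≢0 , IsSquareUnit-± (≡±-sym (*-cong-± c d≡±x)) sq , c≢±d d*d≡a*b ∘ inj₁ , c≢±d d*d≡a*b ∘ inj₂) ,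
        2*c≡a+b , d*d≡a*b
        where
        d*d≡a*b = trans (x≡±y⇒x*x≡y*y d≡±x) x*x≡a*b

      children : ∀ u → Edge (a , b) u → u ≡ (c , x) ⊎ u ≡ (c , - x)
      children (c′ , d) edge with edge-target edge
      ... | refl , inj₁ refl = inj₁ refl
      ... | refl , inj₂ refl = inj₂ refl

      two-or-no-children′ : ExactlyTwoChildren (a , b) ⊎ NoChildren (a , b)
      two-or-no-children′ with IsSquareUnit? (c * x)
      ... | yes sq = inj₁ ((c , x) , (c , - x) , x≢-x 2≢0 x≢0 ∘ cong proj₂ ,
                           child (inj₁ refl) sq , child (inj₂ refl) sq , λ u (_ , edge) → children u edge)
      ... | no ¬sq = inj₂ λ { (c′ , d) ((_ , _ , sq , _) , edge) → ¬sq (square-of-child (edge-target edge) sq) }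
        where
        square-of-child : ∀ {c′ d} → c′ ≡ c × d ≡± x → IsSquareUnit (c′ * d) → IsSquareUnit (c * x)
        square-of-child (refl , d≡±x) = IsSquareUnit-± (*-cong-± c d≡±x)

    two-or-no-children : ∀ v → IsVertex v → ExactlyTwoChildren v ⊎ NoChildren v
    two-or-no-children (a , b) (_ , _ , (x , x≢0 , x*x≡a*b) , a≢b , a≢-b) = two-or-no-children′ x≢0 x*x≡a*b a≢b a≢-b

lemma5p1 : (q : ℕ) → IsPrimePower q → q % 8 ≡ 5 → (F : FiniteField q) → (v : FiniteField.Carrier F × FiniteField.Carrier F) → JGraph.IsVertex F v → JGraph.ExactlyTwoChildren F v ⊎ JGraph.NoChildren F v
lemma5p1 q _ q%8≡5 F = Children.two-or-no-children F 2≢0 √-1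
  where
  open FiniteField F
  open FieldProperties field′ using (2#)
  open FiniteFieldProperties F
  open Counting.Enumerated enumeration _≟_ using (∃?)

  2≢0 : 2# ≢ 0#
  2≢0 2≡0 = let (m , q≡m+m) = 2≡0⇒q≡m+m 2≡0 in q%8≡5⇒q≢m+m q%8≡5 m q≡m+m

  √-1 : ∃[ i ] i * i ≡ - 1#
  √-1 = decidable-stable (∃? (λ i → (i * i) ≟ (- 1#)))
          (λ no√-1 → let (k , q≡3+k*4) = no√-1⇒q≡3+k*4 2≢0 no√-1 in q%8≡5⇒q≢3+k*4 q%8≡5 k q≡3+k*4)
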